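{- The rule $\hbox{Repl}$ is admissible in ${{\bf G3[mic]}^=}^-$: for all terms $s,r$, atomic formulas $P$, variables $v$ not occurring in $s,r$, and finite multisets $\Gamma,\Delta$, if $s=r, P[v/s], P[v/r],\Gamma\Rightarrow\Delta$ is derivable in ${{\bf G3[mic]}^=}^-$, then $s=r,P[v/s],\Gamma\Rightarrow\Delta$ is derivable in ${{\bf G3[mic]}^=}^-$. Equivalently, every derivation in ${{\bf G3[mic]}^=}^-$ extended by $\hbox{Repl}$ can be transformed into a derivation in ${{\bf G3[mic]}^=}^-$ of the same endsequent.
   Context: ${\bf G3[mic]}^=$ denotes any of the multisuccedent $\mathbf{G3}$-style sequent calculi (without structural rules) for minimal, intuitionistic or classical first-order logic over a language with function symbols and equality, in the style of Negri–von Plato: sequents $\Gamma\Rightarrow\Delta$ have finite multisets of formulas on both sides, with the usual initial sequents and logical rules, extended by the equality rules $\hbox{Ref}$: from $t=t,\Gamma\Rightarrow\Delta$ infer $\Gamma\Rightarrow\Delta$ (for any term $t$), and $\hbox{Repl}$: from $s=r, P[v/s], P[v/r],\Gamma\Rightarrow\Delta$ infer $s=r,P[v/s],\Gamma\Rightarrow\Delta$, where $P$ is atomic, $s,r$ are terms and the variable $v$ does not occur in $s,r$. ${{\bf G3[mic]}^=}^-$ is obtained from ${\bf G3[mic]}^=$ by replacing $\hbox{Repl}$ with $\hbox{Repl}^-$: from $s=r, P[v/r],\Gamma\Rightarrow\Delta$ infer $s=r,P[v/s],\Gamma\Rightarrow\Delta$ (same provisos). $P[v/t]$ denotes substitution of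 the term $t$ for $v$ in $P$. -}

module Defs where

open import Data.Nat using (ℕ; zero; suc; _≟_)
open import Data.Fin using (Fin; zero; suc)
open import Data.Maybe using (Maybe; just; nothing)
import Data.Maybe as Maybe
open import Data.Vec using (Vec; []; _∷_)
open import Data.Vec.Relation.Unary.Any as VAny using ()
open import Data.List using (List; []; _∷_)
open import Data.List.Relation.Unary.Any as LAny using ()
open import Data.List.Relation.Binary.Permutation.Propositional using (_↭_)
open import Relation.Nullary using (¬_; yes; no)
open import Relation.Binary.PropositionalEquality using (_≡_)

record Signature : Set₁ where
  field
    Fun    : Set
    fArity : Fun → ℕ
    Pred   : Set
    pArity : Pred → ℕ

data Logic : Set where
  mini intu clas : Logic

data HasLbot : Logic → Set where
  intu : HasLbot intu
  clas : HasLbot clas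

-- Logics using the (Negri–von Plato) G3im-style restricted rules: minimal, intuitionistic.
data IsIntuitionistic : Logic → Set where
  mini : IsIntuitionistic mini
  intu : IsIntuitionistic intu

-- removes the last (= most recently bound) de Bruijn level
unlast : ∀ {k} → Fin (suc k) → Maybe (Fin k)
unlast {zero} zero = nothing
unlast {suc k} zero = just zero
unlast {suc k} (suc i) = Maybe.map suc (unlast i)

module FOL (L : Signature) where
  open Signature L

  -- Locally nameless syntax: free (object) variables are named by ℕ,
  -- bound variables are de Bruijn levels Fin k (k = number of enclosing binders).
  data Term (k : ℕ) : Set where
    var  : ℕ → Term k
    bvar : Fin k → Term k
    fun  : (f : Fun) → Vec (Term k) (fArity f) → Term k

  infix  7 _≐_
  infixr 6 _∧'_
  infixr 5 _∨'_
  infixr 4 _⊃_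

  data Form (k : ℕ) : Set where
    atom       : (p : Pred) → Vec (Term k) (pArity p) → Form k
    _≐_        : Term k → Term k → Form k
    ⊥'         : Form k
    _∧'_ _∨'_ _⊃_ : Form k → Form k → Form k
    ∀' ∃'      : Form (suc k) → Form k

  data Atomic {k : ℕ} : Form k → Set where
    atom : ∀ p ts → Atomic (atom p ts)
    eq   : ∀ s t → Atomic (s ≐ t)

  -- Formulas allowed as principal formulas of initial sequents: atomic formulas
  -- and ⊥ (in minimal logic ⊥ behaves as an atom; in i/c this is an instance of L⊥).
  data Prime {k : ℕ} : Form k → Set where
    atomic : ∀ {A} → Atomic A → Prime A
    bot    : Prime ⊥'

  mutual
    liftT : ∀ {k} → Term 0 → Term k
    liftT (var x) = var x
    liftT (bvar ())
    liftT (fun f ts) = fun f (liftTs ts)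

    liftTs : ∀ {k n} → Vec (Term 0) n → Vec (Term k) n
    liftTs [] = []
    liftTs (t ∷ ts) = liftT t ∷ liftTs ts

  mutual
    substT : ∀ {k} → ℕ → Term 0 → Term k → Term k
    substT v s (var x) with x ≟ v
    ... | yes _ = liftT s
    ... | no  _ = var x
    substT v s (bvar i) = bvar i
    substT v s (fun f ts) = fun f (substTs v s ts)

    substTs : ∀ {k n} → ℕ → Term 0 → Vec (Term k) n → Vec (Term k) n
    substTs v s [] = []
    substTs v s (t ∷ ts) = substT v s t ∷ substTs v s ts

  -- A[v/s]  (no capture possible: s has no dangling bound variables)
  substF : ∀ {k} → ℕ → Term 0 → Form k → Form k
  substF v s (atom p ts) = atom p (substTs v s ts)
  substF v s (t ≐ u) = substT v s t ≐ substT v s u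
  substF v s ⊥' = ⊥'
  substF v s (A ∧' B) = substF v s A ∧' substF v s B
  substF v s (A ∨' B) = substF v s A ∨' substF v s B
  substF v s (A ⊃ B) = substF v s A ⊃ substF v s B
  substF v s (∀' A) = ∀' (substF v s A)
  substF v s (∃' A) = ∃' (substF v s A)

  mutual
    instT : ∀ {k} → Term 0 → Term (suc k) → Term k
    instT t (var x) = var x
    instT t (bvar i) with unlast i
    ... | just j  = bvar j
    ... | nothing = liftT t
    instT t (fun f ts) = fun f (instTs t ts)

    instTs : ∀ {k n} → Term 0 → Vec (Term (suc k)) n → Vec (Term k) n
    instTs t [] = []
    instTs t (u ∷ us) = instT t u ∷ instTs t us

  instF : ∀ {k} → Term 0 → Form (suc k) → Form k
  instF t (atom p ts) = atom p (instTs t ts)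
  instF t (u ≐ w) = instT t u ≐ instT t w
  instF t ⊥' = ⊥'
  instF t (A ∧' B) = instF t A ∧' instF t B
  instF t (A ∨' B) = instF t A ∨' instF t B
  instF t (A ⊃ B) = instF t A ⊃ instF t B
  instF t (∀' A) = ∀' (instF t A)
  instF t (∃' A) = ∃' (instF t A)

  data OccT (x : ℕ) {k : ℕ} : Term k → Set where
    here : OccT x (var x)
    args : ∀ {f ts} → VAny.Any (OccT x) ts → OccT x (fun f ts)

  data OccF (x : ℕ) {k : ℕ} : Form k → Set where
    atom : ∀ {p ts} → VAny.Any (OccT x) ts → OccF x (atom p ts)
    eqˡ  : ∀ {t u} → OccT x t → OccF x (t ≐ u)
    eqʳ  : ∀ {t u} → OccT x u → OccF x (t ≐ u)
    ∧ˡ   : ∀ {A B} → OccF x A → OccF x (A ∧' B)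
    ∧ʳ   : ∀ {A B} → OccF x B → OccF x (A ∧' B)
    ∨ˡ   : ∀ {A B} → OccF x A → OccF x (A ∨' B)
    ∨ʳ   : ∀ {A B} → OccF x B → OccF x (A ∨' B)
    ⊃ˡ   : ∀ {A B} → OccF x A → OccF x (A ⊃ B)
    ⊃ʳ   : ∀ {A B} → OccF x B → OccF x (A ⊃ B)
    ∀'   : ∀ {A} → OccF x A → OccF x (∀' A)
    ∃'   : ∀ {A} → OccF x A → OccF x (∃' A)

  FreshIn : ℕ → List (Form 0) → Set
  FreshIn x Γ = ¬ LAny.Any (OccF x) Γ

  infix 2 _⊢_⇒_

  -- Sequents are pairs of finite multisets, represented by lists taken up
  -- to permutation (constructor `perm`); rules display principal formulas in front.
  data _⊢_⇒_ (ℒ : Logic) : List (Form 0) → List (Form 0) → Set where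
    perm : ∀ {Γ Γ' Δ Δ'} → ℒ ⊢ Γ ⇒ Δ → Γ ↭ Γ' → Δ ↭ Δ' → ℒ ⊢ Γ' ⇒ Δ'
    ax   : ∀ {P Γ Δ} → Prime P → ℒ ⊢ P ∷ Γ ⇒ P ∷ Δ
    L⊥   : ∀ {Γ Δ} → HasLbot ℒ → ℒ ⊢ ⊥' ∷ Γ ⇒ Δ
    L∧   : ∀ {A B Γ Δ} → ℒ ⊢ A ∷ B ∷ Γ ⇒ Δ → ℒ ⊢ (A ∧' B) ∷ Γ ⇒ Δ
    R∧   : ∀ {A B Γ Δ} → ℒ ⊢ Γ ⇒ A ∷ Δ → ℒ ⊢ Γ ⇒ B ∷ Δ → ℒ ⊢ Γ ⇒ (A ∧' B) ∷ Δ
    L∨   : ∀ {A B Γ Δ} → ℒ ⊢ A ∷ Γ ⇒ Δ → ℒ ⊢ B ∷ Γ ⇒ Δ → ℒ ⊢ (A ∨' B) ∷ Γ ⇒ Δ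
    R∨   : ∀ {A B Γ Δ} → ℒ ⊢ Γ ⇒ A ∷ B ∷ Δ → ℒ ⊢ Γ ⇒ (A ∨' B) ∷ Δ
    L⊃c  : ∀ {A B Γ Δ} → ℒ ≡ clas → ℒ ⊢ Γ ⇒ A ∷ Δ → ℒ ⊢ B ∷ Γ ⇒ Δ → ℒ ⊢ (A ⊃ B) ∷ Γ ⇒ Δ
    R⊃c  : ∀ {A B Γ Δ} → ℒ ≡ clas → ℒ ⊢ A ∷ Γ ⇒ B ∷ Δ → ℒ ⊢ Γ ⇒ (A ⊃ B) ∷ Δ
    L⊃i  : ∀ {A B Γ Δ} → IsIntuitionistic ℒ → ℒ ⊢ (A ⊃ B) ∷ Γ ⇒ A ∷ Δ → ℒ ⊢ B ∷ Γ ⇒ Δ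
         → ℒ ⊢ (A ⊃ B) ∷ Γ ⇒ Δ
    R⊃i  : ∀ {A B Γ Δ} → IsIntuitionistic ℒ → ℒ ⊢ A ∷ Γ ⇒ B ∷ [] → ℒ ⊢ Γ ⇒ (A ⊃ B) ∷ Δ
    L∀   : ∀ {A Γ Δ} (t : Term 0) → ℒ ⊢ instF t A ∷ ∀' A ∷ Γ ⇒ Δ → ℒ ⊢ ∀' A ∷ Γ ⇒ Δ
    R∀c  : ∀ {A Γ Δ} (y : ℕ) → ℒ ≡ clas → FreshIn y (∀' A ∷ Γ) → FreshIn y Δ
         → ℒ ⊢ Γ ⇒ instF (var y) A ∷ Δ → ℒ ⊢ Γ ⇒ ∀' A ∷ Δ
    R∀i  : ∀ {A Γ Δ} (y : ℕ) → IsIntuitionistic ℒ → FreshIn y (∀' A ∷ Γ) → FreshIn y Δ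
         → ℒ ⊢ Γ ⇒ instF (var y) A ∷ [] → ℒ ⊢ Γ ⇒ ∀' A ∷ Δ
    L∃   : ∀ {A Γ Δ} (y : ℕ) → FreshIn y (∃' A ∷ Γ) → FreshIn y Δ
         → ℒ ⊢ instF (var y) A ∷ Γ ⇒ Δ → ℒ ⊢ ∃' A ∷ Γ ⇒ Δ
    R∃   : ∀ {A Γ Δ} (t : Term 0) → ℒ ⊢ Γ ⇒ ∃' A ∷ instF t A ∷ Δ → ℒ ⊢ Γ ⇒ ∃' A ∷ Δ
    Ref  : ∀ {Γ Δ} (t : Term 0) → ℒ ⊢ (t ≐ t) ∷ Γ ⇒ Δ → ℒ ⊢ Γ ⇒ Δ
    Repl⁻ : ∀ {Γ Δ} (s r : Term 0) (P : Form 0) (v : ℕ) → Atomic P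
          → ¬ OccT v s → ¬ OccT v r
          → ℒ ⊢ (s ≐ r) ∷ substF v r P ∷ Γ ⇒ Δ
          → ℒ ⊢ (s ≐ r) ∷ substF v s P ∷ Γ ⇒ Δ

module Submission where

-- Write Π ⊢ₑ A when the atom A follows from the atoms of Π by symmetry of
-- equations and replacement of equals.  Repl is the case A = P[v/r],
-- Π = s = r, P[v/s], Γ of: if Π ⊢ₑ A, then A can be dropped from A, Π ⇒ Δ.

open import Defs
open import Data.Nat using (ℕ; suc; _≟_; _⊔_; _≤_; s≤s)
open import Data.Nat.Properties using (m≤m⊔n; m≤n⊔m; ≤-trans; ≤-refl; 1+n≰n)
open import Data.Vec using (Vec; []; _∷_)
import Data.Vec.Relation.Unary.Any as VAny
open import Data.List using (List; _∷_)
open import Data.List.Relation.Unary.Any using (here; there)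
open import Data.List.Membership.Propositional using (_∈_; lose)
open import Data.List.Relation.Binary.Subset.Propositional using (_⊆_)
open import Data.List.Relation.Binary.Subset.Propositional.Properties using (Any-resp-⊆; ∷⁺ʳ)
open import Data.List.Relation.Binary.Permutation.Propositional
  using (_↭_; ↭-refl; ↭-prep; ↭-swap; ↭-trans; ↭-sym)
open import Data.List.Relation.Binary.Permutation.Propositional.Properties
  using (∈-resp-↭; drop-∷)
open import Data.Sum using (_⊎_; inj₁; inj₂)
open import Data.Product using (Σ; ∃₂; _,_; _×_)
open import Data.Empty using (⊥-elim)
open import Relation.Nullary using (¬_; yes; no)
open import Relation.Binary.PropositionalEquality using (_≡_; _≢_; refl; sym; cong; cong₂; subst)

module Substitution (L : Signature) where
  open FOL L

  private variable
    k x v : ℕ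
    Q : Form 0

  mutual
    maxVar : Term k → ℕ
    maxVar (var x) = x
    maxVar (bvar _) = 0
    maxVar (fun _ ts) = maxVars ts

    maxVars : ∀ {n} → Vec (Term k) n → ℕ
    maxVars [] = 0
    maxVars (t ∷ ts) = maxVar t ⊔ maxVars ts

  mutual
    occ⇒≤maxVar : {t : Term k} → OccT x t → x ≤ maxVar t
    occ⇒≤maxVar OccT.here = ≤-refl
    occ⇒≤maxVar (args o) = occs⇒≤maxVars o

    occs⇒≤maxVars : ∀ {n} {ts : Vec (Term k) n} → VAny.Any (OccT x) ts → x ≤ maxVars ts
    occs⇒≤maxVars {ts = t ∷ ts} (VAny.here o) = ≤-trans (occ⇒≤maxVar o) (m≤m⊔n (maxVar t) (maxVars ts))
    occs⇒≤maxVars {ts = t ∷ ts} (VAny.there o) = ≤-trans (occs⇒≤maxVars o) (m≤n⊔m (maxVar t) (maxVars ts))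

  fresh : Term k → Term k → ℕ
  fresh a b = suc (maxVar a ⊔ maxVar b)

  freshˡ : (a b : Term k) → ¬ OccT (fresh a b) a
  freshˡ a b o = 1+n≰n (≤-trans (s≤s (m≤m⊔n (maxVar a) (maxVar b))) (occ⇒≤maxVar o))

  freshʳ : (a b : Term k) → ¬ OccT (fresh a b) b
  freshʳ a b o = 1+n≰n (≤-trans (s≤s (m≤n⊔m (maxVar a) (maxVar b))) (occ⇒≤maxVar o))

  mutual
    liftT-id : (t : Term 0) → liftT t ≡ t
    liftT-id (var x) = refl
    liftT-id (bvar ())
    liftT-id (fun f ts) = cong (fun f) (liftTs-id ts)

    liftTs-id : ∀ {n} (ts : Vec (Term 0) n) → liftTs ts ≡ ts
    liftTs-id [] = refl
    liftTs-id (t ∷ ts) = cong₂ _∷_ (liftT-id t) (liftTs-id ts)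

  substT-var : ∀ v (s : Term 0) → substT v s (var v) ≡ s
  substT-var v s with v ≟ v
  ... | yes _ = liftT-id s
  ... | no v≢v = ⊥-elim (v≢v refl)

  mutual
    substT-fresh : ∀ v s (t : Term k) → ¬ OccT v t → substT v s t ≡ t
    substT-fresh v s (var x) v∉t with x ≟ v
    ... | yes refl = ⊥-elim (v∉t OccT.here)
    ... | no _ = refl
    substT-fresh v s (bvar i) v∉t = refl
    substT-fresh v s (fun f ts) v∉t = cong (fun f) (substTs-fresh v s ts (λ o → v∉t (args o)))

    substTs-fresh : ∀ {n} v s (ts : Vec (Term k) n) → ¬ VAny.Any (OccT v) ts → substTs v s ts ≡ ts
    substTs-fresh v s [] v∉ts = refl
    substTs-fresh v s (t ∷ ts) v∉ts =
      cong₂ _∷_ (substT-fresh v s t (λ o → v∉ts (VAny.here o))) (substTs-fresh v s ts (λ o → v∉ts (VAny.there o)))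

  mutual
    occ-substT : ∀ v (a b : Term 0) (t : Term 0) → OccT x (substT v b t) → OccT x b ⊎ OccT x (substT v a t)
    occ-substT v a b (var y) o with y ≟ v
    ... | yes _ = inj₁ (subst (OccT _) (liftT-id b) o)
    ... | no _ = inj₂ o
    occ-substT v a b (bvar ()) o
    occ-substT v a b (fun f ts) (args o) with occ-substTs v a b ts o
    ... | inj₁ ob = inj₁ ob
    ... | inj₂ o′ = inj₂ (args o′)

    occ-substTs : ∀ {n} v (a b : Term 0) (ts : Vec (Term 0) n)
                → VAny.Any (OccT x) (substTs v b ts) → OccT x b ⊎ VAny.Any (OccT x) (substTs v a ts)
    occ-substTs v a b (t ∷ ts) (VAny.here o) with occ-substT v a b t o
    ... | inj₁ ob = inj₁ ob
    ... | inj₂ o′ = inj₂ (VAny.here o′)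
    occ-substTs v a b (t ∷ ts) (VAny.there o) with occ-substTs v a b ts o
    ... | inj₁ ob = inj₁ ob
    ... | inj₂ o′ = inj₂ (VAny.there o′)

  occ-substF : ∀ v (a b : Term 0) → Atomic Q → OccF x (substF v b Q) → OccT x b ⊎ OccF x (substF v a Q)
  occ-substF v a b (atom p ts) (atom o) with occ-substTs v a b ts o
  ... | inj₁ ob = inj₁ ob
  ... | inj₂ o′ = inj₂ (atom o′)
  occ-substF v a b (eq t u) (eqˡ o) with occ-substT v a b t o
  ... | inj₁ ob = inj₁ ob
  ... | inj₂ o′ = inj₂ (eqˡ o′)
  occ-substF v a b (eq t u) (eqʳ o) with occ-substT v a b u o
  ... | inj₁ ob = inj₁ ob
  ... | inj₂ o′ = inj₂ (eqʳ o′)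

  data IsEq : Form 0 → Set where
    eqE : ∀ t u → IsEq (t ≐ u)

  data IsPred : Form 0 → Set where
    pr : ∀ p ts → IsPred (atom p ts)

  atomic-substF : ∀ v (a : Term 0) → Atomic Q → Atomic (substF v a Q)
  atomic-substF v a (atom p ts) = atom p _
  atomic-substF v a (eq t u) = eq _ _

  isEq-substF : ∀ {a b : Term 0} → Atomic Q → IsEq (substF v b Q) → IsEq (substF v a Q)
  isEq-substF (atom p ts) ()
  isEq-substF (eq t u) _ = eqE _ _

  isPred-substF : ∀ {a b : Term 0} → Atomic Q → IsPred (substF v b Q) → IsPred (substF v a Q)
  isPred-substF (atom p ts) _ = pr p _
  isPred-substF (eq t u) ()

  isPred-atomic : ∀ {A} → IsPred A → Atomic A
  isPred-atomic (pr p ts) = atom p ts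

  isPred≢eq : ∀ {A} {t u : Term 0} → IsPred A → A ≢ (t ≐ u)
  isPred≢eq (pr _ _) ()


module Admissibility (L : Signature) (ℒ : Logic) where
  open FOL L
  open Substitution L

  Ctx : Set
  Ctx = List (Form 0)

  private variable
    v x y : ℕ
    a b s r t u : Term 0
    A B F G Q X : Form 0
    Γ Γ′ Π Π′ Θ Δ : Ctx

  swap : A ∷ B ∷ Γ ↭ B ∷ A ∷ Γ
  swap = ↭-swap _ _ ↭-refl

  rotate : A ∷ B ∷ F ∷ Γ ↭ B ∷ F ∷ A ∷ Γ
  rotate = ↭-trans swap (↭-prep _ swap)

  consUnder : ∀ G → Γ ↭ A ∷ Γ′ → G ∷ Γ ↭ A ∷ G ∷ Γ′
  consUnder G p = ↭-trans (↭-prep G p) (↭-swap G _ ↭-refl)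

  extract : A ∈ Γ → Σ Ctx λ Γ₀ → Γ ↭ A ∷ Γ₀
  extract (here refl) = _ , ↭-refl
  extract (there m) with extract m
  ... | _ , p = _ , consUnder _ p

  locate : F ∷ Γ ↭ X ∷ Π′ → (X ≡ F × Γ ↭ Π′) ⊎ (Σ Ctx λ Γ′ → Γ ↭ X ∷ Γ′ × Π′ ↭ F ∷ Γ′)
  locate p with ∈-resp-↭ (↭-sym p) (here refl)
  ... | here refl = inj₁ (refl , drop-∷ p)
  ... | there m with extract m
  ...   | Γ′ , q = inj₂ (Γ′ , q , drop-∷ (↭-trans (↭-sym p) (consUnder _ q)))

  reorder : ℒ ⊢ Γ ⇒ Δ → Γ ↭ Γ′ → ℒ ⊢ Γ′ ⇒ Δ
  reorder d p = perm d p ↭-refl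

  dropped-⊆ : Γ ↭ A ∷ Γ′ → Γ′ ⊆ Γ
  dropped-⊆ p m = ∈-resp-↭ (↭-sym p) (there m)

  freshIn-⊆ : Γ′ ⊆ Γ → FreshIn y Γ → FreshIn y Γ′
  freshIn-⊆ sub fr o = fr (Any-resp-⊆ sub o)

  replAt : (P : Form 0) (v : ℕ) → Atomic P → ¬ OccT v a → ¬ OccT v b
         → substF v a P ≡ A → substF v b P ≡ B
         → ℒ ⊢ (a ≐ b) ∷ B ∷ Θ ⇒ Δ → ℒ ⊢ (a ≐ b) ∷ A ∷ Θ ⇒ Δ
  replAt P v aP na nb refl refl = Repl⁻ _ _ P v aP na nb

  -- Symmetry: a = b lets one add b = a (Repl⁻ on the pattern w = a for fresh w,
  -- then Ref for a = a).
  addSym : ℒ ⊢ (a ≐ b) ∷ (b ≐ a) ∷ Θ ⇒ Δ → ℒ ⊢ (a ≐ b) ∷ Θ ⇒ Δ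
  addSym {a} {b} d = Ref a (reorder (replAt (var w ≐ a) w (eq _ _) na nb atA atB d) swap)
    where
    w : ℕ
    w = fresh a b
    na : ¬ OccT w a
    na = freshˡ a b
    nb : ¬ OccT w b
    nb = freshʳ a b
    atA : substF w a (var w ≐ a) ≡ (a ≐ a)
    atA = cong₂ _≐_ (substT-var w a) (substT-fresh w a a na)
    atB : substF w b (var w ≐ a) ≡ (b ≐ a)
    atB = cong₂ _≐_ (substT-var w b) (substT-fresh w b a na)

  -- Contraction of equations (Repl⁻ on the pattern a = w, then Ref for a = a).
  contractEq₂ : ℒ ⊢ (a ≐ b) ∷ (a ≐ b) ∷ Θ ⇒ Δ → ℒ ⊢ (a ≐ b) ∷ Θ ⇒ Δ
  contractEq₂ {a} {b} d = Ref a (reorder (replAt (a ≐ var w) w (eq _ _) na nb atA atB d) swap)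
    where
    w : ℕ
    w = fresh a b
    na : ¬ OccT w a
    na = freshˡ a b
    nb : ¬ OccT w b
    nb = freshʳ a b
    atA : substF w a (a ≐ var w) ≡ (a ≐ a)
    atA = cong₂ _≐_ (substT-fresh w a a na) (substT-var w a)
    atB : substF w b (a ≐ var w) ≡ (a ≐ b)
    atB = cong₂ _≐_ (substT-fresh w b a na) (substT-var w b)

  contractEq : (t ≐ u) ∈ Γ → ℒ ⊢ (t ≐ u) ∷ Γ ⇒ Δ → ℒ ⊢ Γ ⇒ Δ
  contractEq m d with extract m
  ... | _ , p = reorder (contractEq₂ (reorder d (↭-prep _ p))) (↭-sym p)

  EqsIn : Ctx → Ctx → Set
  EqsIn Π Γ = ∀ {t u} → (t ≐ u) ∈ Π → (t ≐ u) ∈ Γ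

  EqVar : Ctx → ℕ → Set
  EqVar Π x = ∃₂ λ t u → (t ≐ u) ∈ Π × OccF x (t ≐ u)

  Covered : Form 0 → Ctx → Set
  Covered F Π = ∀ {x} → OccF x F → EqVar Π x

  covered-⊆ : EqsIn Π Π′ → Covered F Π → Covered F Π′
  covered-⊆ sub h o with h o
  ... | t , u , m , o′ = t , u , sub m , o′

  covered-tail : (∀ {t u} → (t ≐ u) ≢ G) → Covered F (G ∷ Γ) → Covered F Γ
  covered-tail G≢eq h o with h o
  ... | _ , _ , here e , _ = ⊥-elim (G≢eq e)
  ... | t , u , there m , o′ = t , u , m , o′

  fresh-covered : Covered F Γ → FreshIn y (G ∷ Γ) → FreshIn y (G ∷ F ∷ Γ)
  fresh-covered h fr (here o) = fr (here o)
  fresh-covered h fr (there (here o)) with h o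
  ... | _ , _ , m , o′ = fr (there (lose m o′))
  fresh-covered h fr (there (there o)) = fr (there o)

  -- Equations leave the antecedent only
  -- through Repl⁻, whose rewritten equation has its variables in s = r or in
  -- P[v/r]; so the covering passes to the premises, and it guarantees that
  -- eigenvariables remain fresh.
  weaken : ℒ ⊢ Π ⇒ Δ → Covered F Π → ℒ ⊢ F ∷ Π ⇒ Δ
  weaken (perm d p q) h = perm (weaken d (covered-⊆ (∈-resp-↭ (↭-sym p)) h)) (↭-prep _ p) q
  weaken (ax a) h = reorder (ax a) swap
  weaken (L⊥ i) h = reorder (L⊥ i) swap
  weaken (L∧ d) h =
    reorder (L∧ (reorder (weaken d (covered-⊆ (λ m → there (there m)) (covered-tail (λ ()) h))) rotate)) swap
  weaken (L∨ d₁ d₂) h =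
    reorder (L∨ (reorder (weaken d₁ (covered-⊆ there h′)) swap) (reorder (weaken d₂ (covered-⊆ there h′)) swap)) swap
    where
    h′ : Covered _ _
    h′ = covered-tail (λ ()) h
  weaken (L⊃c e d₁ d₂) h = reorder (L⊃c e (weaken d₁ h′) (reorder (weaken d₂ (covered-⊆ there h′)) swap)) swap
    where
    h′ : Covered _ _
    h′ = covered-tail (λ ()) h
  weaken (L⊃i i d₁ d₂) h =
    reorder (L⊃i i (reorder (weaken d₁ h) swap)
                   (reorder (weaken d₂ (covered-⊆ there (covered-tail (λ ()) h))) swap)) swap
  weaken (R∧ d₁ d₂) h = R∧ (weaken d₁ h) (weaken d₂ h)
  weaken (R∨ d) h = R∨ (weaken d h)
  weaken (R⊃c e d) h = R⊃c e (reorder (weaken d (covered-⊆ there h)) swap)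
  weaken (R⊃i i d) h = R⊃i i (reorder (weaken d (covered-⊆ there h)) swap)
  weaken (L∀ t d) h = reorder (L∀ t (reorder (weaken d (covered-⊆ there h)) rotate)) swap
  weaken (R∀c y e fr frΔ d) h = R∀c y e (fresh-covered h fr) frΔ (weaken d h)
  weaken (R∀i y i fr frΔ d) h = R∀i y i (fresh-covered h fr) frΔ (weaken d h)
  weaken (L∃ y fr frΔ d) h =
    reorder (L∃ y (fresh-covered h′ fr) frΔ (reorder (weaken d (covered-⊆ there h′)) swap)) swap
    where
    h′ : Covered _ _
    h′ = covered-tail (λ ()) h
  weaken (R∃ t d) h = R∃ t (weaken d h)
  weaken (Ref t d) h = Ref t (reorder (weaken d (covered-⊆ there h)) swap)
  weaken (Repl⁻ s r P v aP ns nr d) h =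
    reorder (Repl⁻ s r P v aP ns nr (reorder (weaken d (λ o → eqVar-repl aP (h o))) rotate)) (↭-sym rotate)
    where
    eqVar-repl : Atomic P → EqVar ((s ≐ r) ∷ substF v s P ∷ Γ) x → EqVar ((s ≐ r) ∷ substF v r P ∷ Γ) x
    eqVar-repl _ (t , u , here e , o) = t , u , here e , o
    eqVar-repl (atom _ _) (_ , _ , there (here ()) , _)
    eqVar-repl (eq a b) (_ , _ , there (here refl) , o) with occ-substF v r s (eq a b) o
    ... | inj₁ os = s , r , here refl , eqˡ os
    ... | inj₂ o′ = _ , _ , there (here refl) , o′
    eqVar-repl _ (t , u , there (there m) , o) = t , u , there (there m) , o

  infix 4 _⊢ₑ_
  data _⊢ₑ_ (Π : Ctx) : Form 0 → Set where
    hyp  : Atomic A → A ∈ Π → Π ⊢ₑ A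
    symm : Π ⊢ₑ (a ≐ b) → Π ⊢ₑ (b ≐ a)
    repl : (Q : Form 0) (v : ℕ) → Atomic Q → ¬ OccT v a → ¬ OccT v b
         → Π ⊢ₑ (a ≐ b) → Π ⊢ₑ substF v a Q → Π ⊢ₑ substF v b Q

  ⊢ₑ-trans : (∀ {B} → Atomic B → B ∈ Π → Π′ ⊢ₑ B) → Π ⊢ₑ A → Π′ ⊢ₑ A
  ⊢ₑ-trans f (hyp aA m) = f aA m
  ⊢ₑ-trans f (symm c) = symm (⊢ₑ-trans f c)
  ⊢ₑ-trans f (repl Q v aQ na nb c₁ c₂) = repl Q v aQ na nb (⊢ₑ-trans f c₁) (⊢ₑ-trans f c₂)

  ⊢ₑ-⊆ : Π ⊆ Π′ → Π ⊢ₑ A → Π′ ⊢ₑ A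
  ⊢ₑ-⊆ sub = ⊢ₑ-trans (λ aB m → hyp aB (sub m))

  ⊢ₑ-↭ : Π ↭ Π′ → Π ⊢ₑ A → Π′ ⊢ₑ A
  ⊢ₑ-↭ p = ⊢ₑ-⊆ (∈-resp-↭ p)

  -- Derivations of equations only use equations, so their variables occur in equations of Π.
  eqVars : Π ⊢ₑ A → IsEq A → Covered A Π
  eqVars (hyp _ m) (eqE t u) o = t , u , m , o
  eqVars (symm c) (eqE _ _) (eqˡ o) = eqVars c (eqE _ _) (eqʳ o)
  eqVars (symm c) (eqE _ _) (eqʳ o) = eqVars c (eqE _ _) (eqˡ o)
  eqVars (repl {a} {b} Q v aQ na nb cab cqa) iA o with occ-substF v a b aQ o
  ... | inj₁ ob = eqVars cab (eqE a b) (eqʳ ob)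
  ... | inj₂ o′ = eqVars cqa (isEq-substF aQ iA) o′

  mutual
    eliminateEq : Π ⊢ₑ A → IsEq A → EqsIn Π Γ → ℒ ⊢ A ∷ Γ ⇒ Δ → ℒ ⊢ Γ ⇒ Δ
    eliminateEq (hyp _ m) (eqE _ _) eqs d = contractEq (eqs m) d
    eliminateEq (symm c) (eqE _ _) eqs d = eliminateEq c (eqE _ _) eqs (addSym (weaken d symm-covered))
      where
      symm-covered : Covered (a ≐ b) ((b ≐ a) ∷ Γ)
      symm-covered (eqˡ o) = _ , _ , here refl , eqʳ o
      symm-covered (eqʳ o) = _ , _ , here refl , eqˡ o
    eliminateEq (repl Q v aQ na nb cab cqa) iA eqs d =
      eliminateEq cqa (isEq-substF aQ iA) eqs (rewriteAtom Q v aQ na nb cab eqs d)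

    rewriteAtom : (Q : Form 0) (v : ℕ) → Atomic Q → ¬ OccT v a → ¬ OccT v b
                → Π ⊢ₑ (a ≐ b) → EqsIn Π Γ → ℒ ⊢ substF v b Q ∷ Γ ⇒ Δ → ℒ ⊢ substF v a Q ∷ Γ ⇒ Δ
    rewriteAtom {Π = Π} {Γ = Γ} Q v aQ na nb cab eqs d =
      eliminateEq cab (eqE _ _) eqs′ (Repl⁻ _ _ Q v aQ na nb (weaken d (covered-⊆ eqs′ (eqVars cab (eqE _ _)))))
      where
      eqs′ : ∀ {G} → EqsIn Π (G ∷ Γ)
      eqs′ m = there (eqs m)

  fromClosure : Π ⊢ₑ A → IsPred A → (∀ {Γ} → EqsIn Π Γ → ℒ ⊢ A ∷ Γ ⇒ Δ) → ℒ ⊢ Π ⇒ Δ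
  fromClosure (hyp _ m) iA k with extract m
  ... | _ , p = reorder (k eqsLeft) (↭-sym p)
    where
    eqsLeft : EqsIn _ _
    eqsLeft m′ with ∈-resp-↭ p m′
    ... | here e = ⊥-elim (isPred≢eq iA (sym e))
    ... | there m″ = m″
  fromClosure (symm _) () k
  fromClosure (repl Q v aQ na nb cab cqa) iA k =
    fromClosure cqa (isPred-substF aQ iA) (λ eqs → rewriteAtom Q v aQ na nb cab eqs (k eqs))

  sideAtom : Atomic A → ¬ Atomic F → F ∷ Γ ↭ A ∷ Π′ → Π′ ⊢ₑ A
           → Σ Ctx λ Γ′ → Γ ↭ A ∷ Γ′ × Π′ ↭ F ∷ Γ′ × Γ′ ⊢ₑ A
  sideAtom aA nF π c with locate π
  ... | inj₁ (refl , _) = ⊥-elim (nF aA)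
  ... | inj₂ (Γ′ , q₁ , q₂) = Γ′ , q₁ , q₂ , ⊢ₑ-trans withoutF c
    where
    withoutF : ∀ {B} → Atomic B → B ∈ _ → Γ′ ⊢ₑ B
    withoutF aB m with ∈-resp-↭ q₂ m
    ... | here refl = ⊥-elim (nF aB)
    ... | there m′ = hyp aB m′

  ⊢ₑ-repl : Atomic Q → ¬ OccT v s → ¬ OccT v r
          → (s ≐ r) ∷ substF v s Q ∷ Γ ⊢ₑ A → (s ≐ r) ∷ substF v r Q ∷ Γ ⊢ₑ A
  ⊢ₑ-repl {Q} {v} {s} {r} aQ ns nr = ⊢ₑ-trans rederive
    where
    rederive : ∀ {B} → Atomic B → B ∈ (s ≐ r) ∷ substF v s Q ∷ _ → (s ≐ r) ∷ substF v r Q ∷ _ ⊢ₑ B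
    rederive aB (here refl) = hyp aB (here refl)
    rederive aB (there (here refl)) =
      repl Q v aQ nr ns (symm (hyp (eq s r) (here refl))) (hyp (atomic-substF v r aQ) (there (here refl)))
    rederive aB (there (there m)) = hyp aB (there (there m))

  eliminatePred : IsPred A → ℒ ⊢ Π ⇒ Δ → Π ↭ A ∷ Π′ → Π′ ⊢ₑ A → ℒ ⊢ Π′ ⇒ Δ
  eliminatePred iA (perm d p q) π c = perm (eliminatePred iA d (↭-trans p π) c) ↭-refl q
  eliminatePred iA (ax aP) π c with locate π
  ... | inj₁ (refl , _) = fromClosure c iA (λ _ → ax aP)
  ... | inj₂ (_ , _ , q) = reorder (ax aP) (↭-sym q)
  eliminatePred iA (L⊥ i) π c with sideAtom (isPred-atomic iA) (λ ()) π c
  ... | _ , _ , q₂ , _ = reorder (L⊥ i) (↭-sym q₂)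
  eliminatePred iA (L∧ d) π c with sideAtom (isPred-atomic iA) (λ ()) π c
  ... | _ , q₁ , q₂ , c′ =
    reorder (L∧ (eliminatePred iA d (consUnder _ (consUnder _ q₁)) (⊢ₑ-⊆ (λ m → there (there m)) c′))) (↭-sym q₂)
  eliminatePred iA (L∨ d₁ d₂) π c with sideAtom (isPred-atomic iA) (λ ()) π c
  ... | _ , q₁ , q₂ , c′ =
    reorder (L∨ (eliminatePred iA d₁ (consUnder _ q₁) (⊢ₑ-⊆ there c′))
                (eliminatePred iA d₂ (consUnder _ q₁) (⊢ₑ-⊆ there c′))) (↭-sym q₂)
  eliminatePred iA (L⊃c e d₁ d₂) π c with sideAtom (isPred-atomic iA) (λ ()) π c
  ... | _ , q₁ , q₂ , c′ =
    reorder (L⊃c e (eliminatePred iA d₁ q₁ c′)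
                   (eliminatePred iA d₂ (consUnder _ q₁) (⊢ₑ-⊆ there c′))) (↭-sym q₂)
  eliminatePred iA (L⊃i i d₁ d₂) π c with sideAtom (isPred-atomic iA) (λ ()) π c
  ... | _ , q₁ , q₂ , c′ =
    reorder (L⊃i i (eliminatePred iA d₁ (consUnder _ q₁) (⊢ₑ-⊆ there c′))
                   (eliminatePred iA d₂ (consUnder _ q₁) (⊢ₑ-⊆ there c′))) (↭-sym q₂)
  eliminatePred iA (R∧ d₁ d₂) π c = R∧ (eliminatePred iA d₁ π c) (eliminatePred iA d₂ π c)
  eliminatePred iA (R∨ d) π c = R∨ (eliminatePred iA d π c)
  eliminatePred iA (R⊃c e d) π c = R⊃c e (eliminatePred iA d (consUnder _ π) (⊢ₑ-⊆ there c))
  eliminatePred iA (R⊃i i d) π c = R⊃i i (eliminatePred iA d (consUnder _ π) (⊢ₑ-⊆ there c))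
  eliminatePred iA (L∀ t d) π c with sideAtom (isPred-atomic iA) (λ ()) π c
  ... | _ , q₁ , q₂ , c′ =
    reorder (L∀ t (eliminatePred iA d (consUnder _ (consUnder _ q₁)) (⊢ₑ-⊆ (λ m → there (there m)) c′))) (↭-sym q₂)
  eliminatePred iA (R∀c y e fr frΔ d) π c =
    R∀c y e (freshIn-⊆ (∷⁺ʳ _ (dropped-⊆ π)) fr) frΔ (eliminatePred iA d π c)
  eliminatePred iA (R∀i y i fr frΔ d) π c =
    R∀i y i (freshIn-⊆ (∷⁺ʳ _ (dropped-⊆ π)) fr) frΔ (eliminatePred iA d π c)
  eliminatePred iA (L∃ y fr frΔ d) π c with sideAtom (isPred-atomic iA) (λ ()) π c
  ... | _ , q₁ , q₂ , c′ =
    reorder (L∃ y (freshIn-⊆ (∷⁺ʳ _ (dropped-⊆ q₁)) fr) frΔ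
                  (eliminatePred iA d (consUnder _ q₁) (⊢ₑ-⊆ there c′))) (↭-sym q₂)
  eliminatePred iA (R∃ t d) π c = R∃ t (eliminatePred iA d π c)
  eliminatePred iA (Ref t d) π c = Ref t (eliminatePred iA d (consUnder _ π) (⊢ₑ-⊆ there c))
  eliminatePred iA (Repl⁻ s r Q v aQ ns nr d) π c with locate π
  ... | inj₁ (e , _) = ⊥-elim (isPred≢eq iA e)
  ... | inj₂ (Γ₁ , q₁ , q₂) with locate q₁
  -- A is the atom Q[v/s] rewritten by Repl⁻: eliminate Q[v/r] from the premise instead
  ...   | inj₁ (refl , q₃) =
    let ρ = ↭-trans q₂ (↭-prep _ (↭-sym q₃))
    in reorder (eliminatePred (isPred-substF aQ iA) d swap
                  (repl Q v aQ ns nr (hyp (eq s r) (here refl)) (⊢ₑ-↭ ρ c))) (↭-sym ρ)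
  -- A is a side formula
  ...   | inj₂ (_ , q₄ , q₅) =
    let ρ = ↭-trans q₂ (↭-prep _ q₅)
    in reorder (Repl⁻ s r Q v aQ ns nr
                  (eliminatePred iA d (consUnder _ (consUnder _ q₄)) (⊢ₑ-repl aQ ns nr (⊢ₑ-↭ ρ c)))) (↭-sym ρ)

  eliminate : Atomic A → Π ⊢ₑ A → ℒ ⊢ A ∷ Π ⇒ Δ → ℒ ⊢ Π ⇒ Δ
  eliminate (atom p ts) c d = eliminatePred (pr p ts) d ↭-refl c
  eliminate (eq t u) c d = eliminateEq c (eqE t u) (λ m → m) d

-- Repl is admissible: P[v/r] follows from s = r and P[v/s] by replacement, hence is redundant.
proposition1 : (L : Signature) → let open FOL L in
    (ℒ : Logic) (s r : Term 0) (P : Form 0) (v : ℕ) (Γ Δ : List (Form 0))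
    → Atomic P → ¬ OccT v s → ¬ OccT v r
    → ℒ ⊢ (s ≐ r) ∷ substF v s P ∷ substF v r P ∷ Γ ⇒ Δ
    → ℒ ⊢ (s ≐ r) ∷ substF v s P ∷ Γ ⇒ Δ
proposition1 L ℒ s r P v Γ Δ aP ns nr d =
  eliminate (atomic-substF v r aP) Pr-derivable (reorder d (↭-sym rotate))
  where
  open FOL L
  open Substitution L
  open Admissibility L ℒ
  Pr-derivable : (s ≐ r) ∷ substF v s P ∷ Γ ⊢ₑ substF v r P
  Pr-derivable = repl P v aP ns nr (hyp (eq s r) (here refl)) (hyp (atomic-substF v s aP) (there (here refl)))
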